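{- For any Visser frame $\langle W,R,S\rangle$, the following are equivalent: (1) $\mathbf{IL}\subseteq\mathrm{Log}(W,R,S)$; (2) there exists a Visser frame $\langle W,R,S'\rangle$ such that $R\subseteq S'$ and $\mathrm{Log}(W,R,S)=\mathrm{Log}(W,R,S')$.
   Context: $\mathcal{L}(\Box,\rhd)$ has propositional variables, $\top,\bot$, $\neg,\land,\lor,\to$, unary $\Box,\Diamond$ ($\Diamond$ dual of $\Box$) and binary $\rhd$. $\mathbf{IL}$ is the smallest set of formulas containing all propositional tautologies, $\Box(p\to q)\to(\Box p\to\Box q)$, $\Box(\Box p\to p)\to\Box p$, J1: $\Box(p\to q)\to(p\rhd q)$; J2: $(p\rhd q)\land(q\rhd r)\to(p\rhd r)$; J3: $(p\rhd r)\land(q\rhd r)\to((p\lor q)\rhd r)$; J4: $(p\rhd q)\to(\Diamond p\to\Diamond q)$; J5: $\Diamond p\rhd p$, closed under modus ponens, necessitation and substitution. A Visser frame is $\langle W,R,S\rangle$ with $W\neq\varnothing$, $R$ a transitive and conversely well-founded binary relation on $W$ (no infinite $R$-increasing sequence), and $S$ a transitive and reflexive binary relation on $W$. A Visser model on it is a relation $\Vdash$ between points and formulas with the Boolean clauses, $x\Vdash\Box\varphi$ iff $\forall y(xRy\Rightarrow y\Vdash\varphi)$, $x\Vdash\Diamond\varphi$ iff $\exists y(xRy\wedge y\Vdash\varphi)$, and $x\Vdash\varphi\rhd\psi$ iff for all $y$ with $xRy$ and $y\Vdash\varphi$ there is $z$ with $xRz$, $ySz$ and $z\Vdash\psi$.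 $\mathrm{Log}(W,R,S)$ is the set of formulas true at every point of every Visser model on $\langle W,R,S\rangle$. -}

module Defs where

open import Level using (0ℓ)
open import Data.Nat using (ℕ)
open import Data.Bool using (Bool; true; false; _∧_; _∨_; not)
open import Data.Empty using (⊥)
open import Data.Unit using (⊤)
open import Data.Product using (_×_; Σ; _,_)
open import Data.Sum using (_⊎_)
open import Function using (flip)
open import Relation.Binary.Core using (Rel)
open import Relation.Binary.Definitions using (Reflexive; Transitive)
open import Relation.Binary.PropositionalEquality using (_≡_)
open import Induction.WellFounded using (WellFounded)

infixr 6 _∧'_
infixr 5 _∨'_
infixr 4 _⊃_
infix 7 _▷_

data Fm : Set where
  var  : ℕ → Fm
  ⊤'   : Fm
  ⊥'   : Fm
  ¬'_  : Fm → Fm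
  _∧'_ : Fm → Fm → Fm
  _∨'_ : Fm → Fm → Fm
  _⊃_  : Fm → Fm → Fm
  □_   : Fm → Fm
  _▷_  : Fm → Fm → Fm

◇_ : Fm → Fm
◇ φ = ¬' (□ (¬' φ))

sub : (ℕ → Fm) → Fm → Fm
sub σ (var n)  = σ n
sub σ ⊤'       = ⊤'
sub σ ⊥'       = ⊥'
sub σ (¬' φ)   = ¬' sub σ φ
sub σ (φ ∧' ψ) = sub σ φ ∧' sub σ ψ
sub σ (φ ∨' ψ) = sub σ φ ∨' sub σ ψ
sub σ (φ ⊃ ψ)  = sub σ φ ⊃ sub σ ψ
sub σ (□ φ)    = □ sub σ φ
sub σ (φ ▷ ψ)  = sub σ φ ▷ sub σ ψ

-- Propositional tautologies: formulas true under every Boolean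
-- assignment to their maximal non-Boolean subformulas (variables,
-- □-formulas and ▷-formulas), i.e. substitution instances of
-- propositional tautologies.

evalB : (Fm → Bool) → Fm → Bool
evalB v (var n)  = v (var n)
evalB v ⊤'       = true
evalB v ⊥'       = false
evalB v (¬' φ)   = not (evalB v φ)
evalB v (φ ∧' ψ) = evalB v φ ∧ evalB v ψ
evalB v (φ ∨' ψ) = evalB v φ ∨ evalB v ψ
evalB v (φ ⊃ ψ)  = not (evalB v φ) ∨ evalB v ψ
evalB v (□ φ)    = v (□ φ)
evalB v (φ ▷ ψ)  = v (φ ▷ ψ)

Tautology : Fm → Set
Tautology φ = (v : Fm → Bool) → evalB v φ ≡ true

p q r : Fm
p = var 0
q = var 1
r = var 2

data IL : Fm → Set where
  taut : ∀ {φ} → Tautology φ → IL φ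
  axK  : IL (□ (p ⊃ q) ⊃ (□ p ⊃ □ q))
  axL  : IL (□ (□ p ⊃ p) ⊃ □ p)
  J1   : IL (□ (p ⊃ q) ⊃ (p ▷ q))
  J2   : IL ((p ▷ q) ∧' (q ▷ r) ⊃ (p ▷ r))
  J3   : IL ((p ▷ r) ∧' (q ▷ r) ⊃ ((p ∨' q) ▷ r))
  J4   : IL ((p ▷ q) ⊃ (◇ p ⊃ ◇ q))
  J5   : IL ((◇ p) ▷ p)
  mp   : ∀ {φ ψ} → IL (φ ⊃ ψ) → IL φ → IL ψ
  nec  : ∀ {φ} → IL φ → IL (□ φ)
  subst : ∀ {φ} (σ : ℕ → Fm) → IL φ → IL (sub σ φ)

record IsVisserFrame (W : Set) (R S : Rel W 0ℓ) : Set where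
  field
    nonempty : W
    R-trans  : Transitive R
    R-cwf    : WellFounded (flip R)
    S-refl   : Reflexive S
    S-trans  : Transitive S

Forces : {W : Set} (R S : Rel W 0ℓ) (V : ℕ → W → Set) → W → Fm → Set
Forces R S V x (var n)  = V n x
Forces R S V x ⊤'       = ⊤
Forces R S V x ⊥'       = ⊥
Forces R S V x (¬' φ)   = Forces R S V x φ → ⊥
Forces R S V x (φ ∧' ψ) = Forces R S V x φ × Forces R S V x ψ
Forces R S V x (φ ∨' ψ) = Forces R S V x φ ⊎ Forces R S V x ψ
Forces R S V x (φ ⊃ ψ)  = Forces R S V x φ → Forces R S V x ψ
Forces R S V x (□ φ)    = ∀ y → R x y → Forces R S V y φ
Forces {W} R S V x (φ ▷ ψ) =
  ∀ y → R x y → Forces R S V y φ →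
    Σ W (λ z → R x z × S y z × Forces R S V z ψ)

Log : (W : Set) (R S : Rel W 0ℓ) → Fm → Set₁
Log W R S φ = (V : ℕ → W → Set) (x : W) → Forces R S V x φ

-- IL is valid on ⟨W,R,S⟩ exactly when R x y and R y z imply S y z: the
-- axiom J5, read under the valuation {z}, forces this condition, and
-- conversely it is all the soundness argument needs from S.  Forcing only
-- ever consults S between two R-successors of a common point, so S may be
-- replaced by S' y z := (y has an R-predecessor → z has one and S y z),
-- which leaves the logic unchanged and, by the condition, contains R.

module Submission where

open import Defs
open import Level using (0ℓ)
open import Data.Bool using (Bool; true)
open import Data.Empty using (⊥-elim)
open import Data.Nat using (ℕ)
open import Data.Product using (Σ; _×_; _,_; proj₂)
open import Data.Sum using (inj₁; inj₂)
open import Data.Unit using (tt)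
open import Function.Bundles using (_⇔_; mk⇔; Equivalence)
open import Function.Construct.Symmetry using (⇔-sym)
open import Relation.Binary.Core using (Rel; _⇒_)
open import Relation.Binary.PropositionalEquality using (_≡_; refl)
open import Relation.Nullary using (yes; no; does; proof)
open import Relation.Nullary.Reflects
  using (Reflects; ofʸ; ofⁿ; ¬-reflects; _×-reflects_; _⊎-reflects_; _→-reflects_)
open import Axiom.ExcludedMiddle using (ExcludedMiddle)
open import Induction.WellFounded using (Acc; acc)

module _ {W : Set} (R : Rel W 0ℓ) where

  HasPredecessor : W → Set
  HasPredecessor y = Σ W (λ x → R x y)

  AgreeOnSiblings : Rel W 0ℓ → Rel W 0ℓ → Set
  AgreeOnSiblings S₁ S₂ = ∀ {x y z} → R x y → R x z → S₁ y z ⇔ S₂ y z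

  J5Condition : Rel W 0ℓ → Set
  J5Condition S = ∀ {x y z} → R x y → R y z → S y z

  AgreeOnSiblings-sym : ∀ {S₁ S₂} → AgreeOnSiblings S₁ S₂ → AgreeOnSiblings S₂ S₁
  AgreeOnSiblings-sym agree rxy rxz = ⇔-sym (agree rxy rxz)

  Forces-transfer : ∀ {S₁ S₂} → AgreeOnSiblings S₁ S₂ →
                    ∀ V x φ → Forces R S₁ V x φ → Forces R S₂ V x φ
  Forces-transfer agree V x (var n) a = a
  Forces-transfer agree V x ⊤' a = a
  Forces-transfer agree V x ⊥' a = a
  Forces-transfer agree V x (¬' φ) a b =
    a (Forces-transfer (AgreeOnSiblings-sym agree) V x φ b)
  Forces-transfer agree V x (φ ∧' ψ) (a , b) =
    Forces-transfer agree V x φ a , Forces-transfer agree V x ψ b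
  Forces-transfer agree V x (φ ∨' ψ) (inj₁ a) = inj₁ (Forces-transfer agree V x φ a)
  Forces-transfer agree V x (φ ∨' ψ) (inj₂ b) = inj₂ (Forces-transfer agree V x ψ b)
  Forces-transfer agree V x (φ ⊃ ψ) f a =
    Forces-transfer agree V x ψ (f (Forces-transfer (AgreeOnSiblings-sym agree) V x φ a))
  Forces-transfer agree V x (□ φ) f y rxy = Forces-transfer agree V y φ (f y rxy)
  Forces-transfer agree V x (φ ▷ ψ) f y rxy a
    with f y rxy (Forces-transfer (AgreeOnSiblings-sym agree) V y φ a)
  ... | z , rxz , syz , b =
    z , rxz , Equivalence.to (agree rxy rxz) syz , Forces-transfer agree V z ψ b

  Log-cong : ∀ {S₁ S₂} → AgreeOnSiblings S₁ S₂ → ∀ φ → Log W R S₁ φ ⇔ Log W R S₂ φ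
  Log-cong agree φ =
    mk⇔ (λ valid V x → Forces-transfer agree V x φ (valid V x))
        (λ valid V x → Forces-transfer (AgreeOnSiblings-sym agree) V x φ (valid V x))

  module _ (S : Rel W 0ℓ) where

    module _ (σ : ℕ → Fm) (V : ℕ → W → Set) where

      substituted : ℕ → W → Set
      substituted n y = Forces R S V y (σ n)

      Forces-sub⁺ : ∀ x φ → Forces R S V x (sub σ φ) → Forces R S substituted x φ
      Forces-sub⁻ : ∀ x φ → Forces R S substituted x φ → Forces R S V x (sub σ φ)
      Forces-sub⁺ x (var n) a = a
      Forces-sub⁺ x ⊤' a = a
      Forces-sub⁺ x ⊥' a = a
      Forces-sub⁺ x (¬' φ) a b = a (Forces-sub⁻ x φ b)
      Forces-sub⁺ x (φ ∧' ψ) (a , b) = Forces-sub⁺ x φ a , Forces-sub⁺ x ψ b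
      Forces-sub⁺ x (φ ∨' ψ) (inj₁ a) = inj₁ (Forces-sub⁺ x φ a)
      Forces-sub⁺ x (φ ∨' ψ) (inj₂ b) = inj₂ (Forces-sub⁺ x ψ b)
      Forces-sub⁺ x (φ ⊃ ψ) f a = Forces-sub⁺ x ψ (f (Forces-sub⁻ x φ a))
      Forces-sub⁺ x (□ φ) f y rxy = Forces-sub⁺ y φ (f y rxy)
      Forces-sub⁺ x (φ ▷ ψ) f y rxy a with f y rxy (Forces-sub⁻ y φ a)
      ... | z , rxz , syz , b = z , rxz , syz , Forces-sub⁺ z ψ b
      Forces-sub⁻ x (var n) a = a
      Forces-sub⁻ x ⊤' a = a
      Forces-sub⁻ x ⊥' a = a
      Forces-sub⁻ x (¬' φ) a b = a (Forces-sub⁺ x φ b)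
      Forces-sub⁻ x (φ ∧' ψ) (a , b) = Forces-sub⁻ x φ a , Forces-sub⁻ x ψ b
      Forces-sub⁻ x (φ ∨' ψ) (inj₁ a) = inj₁ (Forces-sub⁻ x φ a)
      Forces-sub⁻ x (φ ∨' ψ) (inj₂ b) = inj₂ (Forces-sub⁻ x ψ b)
      Forces-sub⁻ x (φ ⊃ ψ) f a = Forces-sub⁻ x ψ (f (Forces-sub⁺ x φ a))
      Forces-sub⁻ x (□ φ) f y rxy = Forces-sub⁻ y φ (f y rxy)
      Forces-sub⁻ x (φ ▷ ψ) f y rxy a with f y rxy (Forces-sub⁺ y φ a)
      ... | z , rxz , syz , b = z , rxz , syz , Forces-sub⁻ z ψ b

    Log-sub : ∀ σ φ → Log W R S φ → Log W R S (sub σ φ)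
    Log-sub σ φ valid V x = Forces-sub⁻ σ V x φ (valid (substituted σ V) x)

    module _ (em : ExcludedMiddle 0ℓ) (V : ℕ → W → Set) (x : W) where

      truthValue : Fm → Bool
      truthValue χ = does (em {Forces R S V x χ})

      Forces-reflects-evalB : ∀ φ → Reflects (Forces R S V x φ) (evalB truthValue φ)
      Forces-reflects-evalB (var n) = proof em
      Forces-reflects-evalB ⊤' = ofʸ tt
      Forces-reflects-evalB ⊥' = ofⁿ (λ ())
      Forces-reflects-evalB (¬' φ) = ¬-reflects (Forces-reflects-evalB φ)
      Forces-reflects-evalB (φ ∧' ψ) = Forces-reflects-evalB φ ×-reflects Forces-reflects-evalB ψ
      Forces-reflects-evalB (φ ∨' ψ) = Forces-reflects-evalB φ ⊎-reflects Forces-reflects-evalB ψ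
      Forces-reflects-evalB (φ ⊃ ψ) = Forces-reflects-evalB φ →-reflects Forces-reflects-evalB ψ
      Forces-reflects-evalB (□ φ) = proof em
      Forces-reflects-evalB (φ ▷ ψ) = proof em

      Tautology⇒Forces : ∀ φ → Tautology φ → Forces R S V x φ
      Tautology⇒Forces φ tautology
        with evalB truthValue φ | tautology truthValue | Forces-reflects-evalB φ
      ... | true | _ | ofʸ a = a

    J5-valid⇒J5Condition : Log W R S (◇ p ▷ p) → J5Condition S
    J5-valid⇒J5Condition valid {x} {y} {z} rxy ryz
      with valid (λ _ u → u ≡ z) x y rxy (λ ¬◇z → ¬◇z z ryz refl)
    ... | .z , _ , syz , refl = syz

    module _ (em : ExcludedMiddle 0ℓ) (frame : IsVisserFrame W R S) (j5 : J5Condition S) where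
      open IsVisserFrame frame

      Löb-forced : ∀ V x → Forces R S V x (□ (□ p ⊃ p)) →
                   ∀ y → Acc (λ a b → R b a) y → R x y → V 0 y
      Löb-forced V x h y (acc rec) rxy =
        h y rxy (λ w ryw → Löb-forced V x h w (rec ryw) (R-trans rxy ryw))

      IL-sound : ∀ φ → IL φ → Log W R S φ
      IL-sound φ (taut t) V x = Tautology⇒Forces em V x φ t
      IL-sound _ axK V x f g y rxy = f y rxy (g y rxy)
      IL-sound _ axL V x h y rxy = Löb-forced V x h y (R-cwf y) rxy
      IL-sound _ J1 V x f y rxy a = y , rxy , S-refl , f y rxy a
      IL-sound _ J2 V x (f , g) y rxy a with f y rxy a
      ... | z , rxz , syz , b with g z rxz b
      ... | w , rxw , szw , c = w , rxw , S-trans syz szw , c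
      IL-sound _ J3 V x (f , g) y rxy (inj₁ a) = f y rxy a
      IL-sound _ J3 V x (f , g) y rxy (inj₂ b) = g y rxy b
      IL-sound _ J4 V x f ¬◇p □¬q =
        ¬◇p (λ y rxy a → let (z , rxz , _ , b) = f y rxy a in □¬q z rxz b)
      IL-sound _ J5 V x y rxy ¬□¬p with em {Σ W (λ w → R y w × V 0 w)}
      ... | yes (w , ryw , a) = w , R-trans rxy ryw , j5 rxy ryw , a
      ... | no ∄w = ⊥-elim (¬□¬p (λ w ryw a → ∄w (w , ryw , a)))
      IL-sound _ (mp {φ} {ψ} d e) V x = IL-sound (φ ⊃ ψ) d V x (IL-sound φ e V x)
      IL-sound _ (nec {φ} d) V x y rxy = IL-sound φ d V y
      IL-sound _ (subst {φ} σ d) = Log-sub σ φ (IL-sound φ d)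

    predecessorGuarded : Rel W 0ℓ
    predecessorGuarded y z = HasPredecessor y → HasPredecessor z × S y z

    predecessorGuarded-isVisserFrame : IsVisserFrame W R S → IsVisserFrame W R predecessorGuarded
    predecessorGuarded-isVisserFrame frame = record
      { nonempty = nonempty
      ; R-trans  = R-trans
      ; R-cwf    = R-cwf
      ; S-refl   = λ py → py , S-refl
      ; S-trans  = λ s t py → let (pz , syz) = s py ; (pw , szw) = t pz
                              in pw , S-trans syz szw
      }
      where open IsVisserFrame frame

    predecessorGuarded-agreeOnSiblings : AgreeOnSiblings S predecessorGuarded
    predecessorGuarded-agreeOnSiblings {x} rxy rxz =
      mk⇔ (λ syz _ → (x , rxz) , syz) (λ s → proj₂ (s (x , rxy)))

    J5Condition⇒R⊆predecessorGuarded : J5Condition S → R ⇒ predecessorGuarded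
    J5Condition⇒R⊆predecessorGuarded j5 {y} ryz (x , rxy) = (y , ryz) , j5 rxy ryz

corollary5p7 : ExcludedMiddle 0ℓ → (W : Set) (R S : Rel W 0ℓ) → IsVisserFrame W R S →
    ((∀ φ → IL φ → Log W R S φ)
      ⇔ Σ (Rel W 0ℓ) (λ S' → IsVisserFrame W R S' × (R ⇒ S') × (∀ φ → Log W R S φ ⇔ Log W R S' φ)))
corollary5p7 em W R S frame = mk⇔ forward backward
  where
  forward : (∀ φ → IL φ → Log W R S φ) →
            Σ (Rel W 0ℓ) (λ S' → IsVisserFrame W R S' × (R ⇒ S') × (∀ φ → Log W R S φ ⇔ Log W R S' φ))
  forward sound =
    predecessorGuarded R S
    , predecessorGuarded-isVisserFrame R S frame
    , J5Condition⇒R⊆predecessorGuarded R S (J5-valid⇒J5Condition R S (sound _ J5))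
    , Log-cong R (predecessorGuarded-agreeOnSiblings R S)

  backward : Σ (Rel W 0ℓ) (λ S' → IsVisserFrame W R S' × (R ⇒ S') × (∀ φ → Log W R S φ ⇔ Log W R S' φ)) →
             ∀ φ → IL φ → Log W R S φ
  backward (S' , frame' , R⊆S' , sameLog) φ d =
    Equivalence.from (sameLog φ) (IL-sound R S' em frame' (λ _ ryz → R⊆S' ryz) φ d)
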